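{- Let $\Gamma$ be a residually connected incidence geometry over $I=\{0,\dots,n-1\}$, $n\ge3$, satisfying $(B_1)$ and $(B_2)$ for $\{0,1\}$, with $\Gamma[0,1]$ not bipartite. The map $\alpha$ on the elements of $\mathcal{P}(\Gamma)(0,1)$ defined by $\alpha(p,i)=(p,i+1\bmod 2)$ for $i\in\{0,1\}$ and $\alpha(x,P)=(x,\bar P)$ is a correlation of $\mathcal{P}(\Gamma)(0,1)$.
   Context: A correlation of a geometry is a bijection of its elements preserving incidence and mapping elements of the same type to elements of the same type. Standard notions: incidence geometry, residues, truncations, $S_i=t^{ -1}(i)$, $\sigma_0(x)$ = $0$-elements incident to $x$. $(B_1)$: $\Gamma[0,1]$ is the geometry of a simple graph (vertices = $0$-elements, edges = $1$-elements); $p\sim q$ denotes adjacency. $(B_2)$: for an edge $e$ and $x$ of type $\notin\{0,1\}$, $e*x$ iff $\sigma_0(e)\subseteq\sigma_0(x)$. For a connected graph $\mathcal{G}$ on $V$, $\pi(\mathcal{G})$ is the set of classes of "joined by an even walk"; $\bar P=V\setminus P$ if $\mathcal{G}$ is bipartite, $\bar P=P$ otherwise. $\mathcal{P}(\Gamma)(0,1)$: elements $(p,0)$, $(p,1)$ for $p\in S_0$ (types 0, 1) and $(x,P_x)$ for $x\in S_i$, $i\ge2$, $P_x\in\pi(\Gamma_x[0,1])$ (type $i$); incidence: $(x,P_x)*'(y,P_y)$ iff $x*y$ and $P_x\cap P_y\ne\emptyset$; $(p,0)*'(y,P_y)$ iff $p*y$, $p\in P_y$; $(q,1)*'(y,P_y)$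 iff $q*y$, $q\in\bar P_y$; $(p,0)*'(q,1)$ iff $p\sim q$. -}

module Defs where

open import Data.Nat using (ℕ; zero; suc; _+_)
open import Data.Fin using (Fin; zero; suc)
open import Data.Maybe using (Maybe; just; nothing)
open import Data.Bool using (Bool)
open import Data.Product using (Σ; ∃; ∃₂; _×_; _,_; proj₁)
open import Data.Empty using (⊥)
open import Relation.Nullary using (¬_)
open import Relation.Binary.PropositionalEquality using (_≡_; _≢_)
open import Relation.Binary.Construct.Closure.ReflexiveTransitive using (Star)
open import Function.Bundles using (_⇔_)

record IncidenceSystem (n : ℕ) : Set₁ where
  field
    X   : Set
    t   : X → Fin n
    _*_ : X → X → Set

module _ {n : ℕ} (Γ : IncidenceSystem n) where
  open IncidenceSystem Γ

  -- a flag: at most one element of each type (partial map type ↦ element),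
  -- pairwise incident
  record Flag : Set where
    field
      F        : Fin n → Maybe X
      typed    : ∀ i x → F i ≡ just x → t x ≡ i
      incident : ∀ i j x y → F i ≡ just x → F j ≡ just y → x * y

  _⊆F_ : (Fin n → Maybe X) → (Fin n → Maybe X) → Set
  F ⊆F G = ∀ i x → F i ≡ just x → G i ≡ just x

  IsChamber : (Fin n → Maybe X) → Set
  IsChamber F = ∀ i → ∃ λ x → F i ≡ just x

  record IsGeometry : Set where
    field
      *-refl  : ∀ x → x * x
      *-sym   : ∀ {x y} → x * y → y * x
      *-type  : ∀ {x y} → x * y → t x ≡ t y → x ≡ y
      t-surj  : ∀ i → ∃ λ x → t x ≡ i
      chamber : ∀ (φ : Flag) → ∃ λ (ψ : Flag) →
                  (Flag.F φ ⊆F Flag.F ψ) × IsChamber (Flag.F ψ)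

  InRes : (Fin n → Maybe X) → X → Set
  InRes F y = (F (t y) ≡ nothing) × (∀ i x → F i ≡ just x → y * x)

  CorankAtLeast2 : (Fin n → Maybe X) → Set
  CorankAtLeast2 F = ∃₂ λ i j → (i ≢ j) × (F i ≡ nothing) × (F j ≡ nothing)

  -- every residue of rank ≥ 2 (including Γ itself) has connected incidence graph
  ResiduallyConnected : Set
  ResiduallyConnected = ∀ (φ : Flag) → CorankAtLeast2 (Flag.F φ) →
    ∀ y z → InRes (Flag.F φ) y → InRes (Flag.F φ) z →
    Star (λ a b → InRes (Flag.F φ) a × InRes (Flag.F φ) b × (a * b)) y z

data Walk {V : Set} (A : V → V → Set) : ℕ → V → V → Set where
  []  : ∀ {p} → Walk A 0 p p
  _∷_ : ∀ {p q r k} → A p q → Walk A k q r → Walk A (suc k) p r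

module _ {m : ℕ} (Γ : IncidenceSystem (3 + m)) where
  open IncidenceSystem Γ

  t0 t1 : Fin (3 + m)
  t0 = zero
  t1 = suc zero

  σ₀ : X → X → Set
  σ₀ x p = (t p ≡ t0) × (p * x)

  Adj : X → X → Set
  Adj p q = (t p ≡ t0) × (t q ≡ t0) × (p ≢ q) ×
            (∃ λ e → (t e ≡ t1) × (e * p) × (e * q))

  -- (B1): Γ[0,1] is the geometry of a simple graph
  B1 : Set
  B1 = (∀ e → t e ≡ t1 → ∃₂ λ p q → (p ≢ q) × σ₀ e p × σ₀ e q ×
                         (∀ r → σ₀ e r → (r ≡ p) Data.Sum.⊎ (r ≡ q)))
     × (∀ e f → t e ≡ t1 → t f ≡ t1 → (∀ r → σ₀ e r ⇔ σ₀ f r) → e ≡ f)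
    where import Data.Sum

  B2 : Set
  B2 = ∀ e x → t e ≡ t1 → t x ≢ t0 → t x ≢ t1 →
       ((e * x) ⇔ (∀ p → σ₀ e p → σ₀ x p))

  BipartiteOn : (X → Set) → (X → X → Set) → Set
  BipartiteOn V A = ∃ λ (c : X → Bool) → ∀ p q → V p → V q → A p q → c p ≢ c q

  Bipartite01 : Set
  Bipartite01 = BipartiteOn (λ p → t p ≡ t0) Adj

  -- the graph Γ_x[0,1]: vertices = 0-elements incident to x,
  -- edges = 1-elements incident to x
  VertexAt : X → X → Set
  VertexAt x p = (t p ≡ t0) × (p * x)

  AdjAt : X → X → X → Set
  AdjAt x p q = VertexAt x p × VertexAt x q × (p ≢ q) ×
                (∃ λ e → (t e ≡ t1) × (e * x) × (e * p) × (e * q))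

  BipartiteAt : X → Set
  BipartiteAt x = BipartiteOn (VertexAt x) (AdjAt x)

  EvenJoined : X → X → X → Set
  EvenJoined x p q = VertexAt x p × VertexAt x q × ∃ λ k → Walk (AdjAt x) (k + k) p q

  IsClass : X → (X → Set) → Set
  IsClass x P = ∃ λ p → VertexAt x p × (∀ q → P q ⇔ EvenJoined x p q)

  -- P̄ : V ∖ P if Γ_x[0,1] is bipartite, P otherwise
  Bar : X → (X → Set) → X → Set
  Bar x P q = (BipartiteAt x → VertexAt x q × ¬ P q) × (¬ BipartiteAt x → P q)

  HighType : X → Set
  HighType x = (t x ≢ t0) × (t x ≢ t1)

  data PElt : Set₁ where
    pt0 : (p : X) → t p ≡ t0 → PElt
    pt1 : (p : X) → t p ≡ t0 → PElt
    cls : (x : X) → HighType x → (P : X → Set) → IsClass x P → PElt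

  -- equality of elements of 𝒫(Γ)(0,1) (classes compared extensionally)
  _≈_ : PElt → PElt → Set
  pt0 p _ ≈ pt0 q _ = p ≡ q
  pt1 p _ ≈ pt1 q _ = p ≡ q
  cls x _ P _ ≈ cls y _ Q _ = (x ≡ y) × (∀ q → P q ⇔ Q q)
  _ ≈ _ = ⊥

  t′ : PElt → Fin (3 + m)
  t′ (pt0 _ _) = t0
  t′ (pt1 _ _) = t1
  t′ (cls x _ _ _) = t x

  _*′_ : PElt → PElt → Set
  pt0 p _ *′ pt0 q _ = p ≡ q
  pt1 p _ *′ pt1 q _ = p ≡ q
  pt0 p _ *′ pt1 q _ = Adj p q
  pt1 q _ *′ pt0 p _ = Adj p q
  pt0 p _ *′ cls y _ P _ = (p * y) × P p
  cls y _ P _ *′ pt0 p _ = (p * y) × P p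
  pt1 q _ *′ cls y _ P _ = (q * y) × Bar y P q
  cls y _ P _ *′ pt1 q _ = (q * y) × Bar y P q
  cls x _ P _ *′ cls y _ Q _ = (x * y) × ∃ λ q → P q × Q q

  IsAlpha : (PElt → PElt) → Set₁
  IsAlpha f =
      (∀ p h → f (pt0 p h) ≈ pt1 p h)
    × (∀ p h → f (pt1 p h) ≈ pt0 p h)
    × (∀ x h P c → Σ (X → Set) λ Q → Σ (IsClass x Q) λ c′ →
         (f (cls x h P c) ≈ cls x h Q c′) × (∀ q → Q q ⇔ Bar x P q))

  IsCorrelation : (PElt → PElt) → Set₁
  IsCorrelation f =
      (∀ a b → a ≈ b → f a ≈ f b)
    × (∀ a b → f a ≈ f b → a ≈ b)
    × (∀ b → Σ PElt λ a → f a ≈ b)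
    × (∀ a b → t′ a ≡ t′ b → t′ (f a) ≡ t′ (f b))
    × (∀ a b → (a *′ b) ⇔ (f a *′ f b))

{-# OPTIONS --safe #-}
-- Residual connectedness, by induction on corank, makes every Γ_x[0,1] (t x ≥ 2) connected. So the
-- even-walk classes of Γ_x[0,1] are its two colour classes if it is bipartite and its whole vertex
-- set otherwise; either way P̄ is again a class and P ↦ P̄ is an involution, which settles everything
-- but incidence between classes. There, if r ∈ P ∩ Q and x * y, a chamber through {x, y, r} has an
-- edge e through r, and by (B₁) and (B₂) the other end of e is adjacent to r in both Γ_x[0,1] and
-- Γ_y[0,1], hence lies in P̄ ∩ Q̄.
module Submission where

open import Defs
open import Axiom.ExcludedMiddle using (ExcludedMiddle)
open import Data.Bool using (Bool; true; false; not; _xor_)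
open import Data.Bool.Properties
  using (not-distribˡ-xor; not-distribʳ-xor; xor-comm; xor-inverseʳ; ¬-not)
open import Data.Empty using (⊥-elim)
open import Data.Fin using (Fin; _≟_)
open import Data.Fin.Subset using (Subset; _∈_; _⊂_; ∣_∣)
open import Data.Fin.Subset.Properties using (p⊂q⇒∣p∣<∣q∣)
open import Data.Maybe using (Maybe; just; nothing; is-nothing)
open import Data.Maybe.Properties using (just-injective)
open import Data.Nat using (ℕ; zero; suc; _+_; _<_)
open import Data.Nat.Induction using (<-wellFounded)
open import Data.Nat.Properties using (+-suc)
open import Data.Product using (Σ; ∃; _×_; _,_; proj₁; proj₂; map; map₂)
open import Data.Product.Function.NonDependent.Propositional using (_×-⇔_)
open import Data.Sum using (inj₁; inj₂)
open import Data.Vec using (tabulate)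
open import Data.Vec.Properties using (lookup∘tabulate; []=⇒lookup; lookup⇒[]=)
open import Function using (_∘_)
open import Function.Bundles using (_⇔_; mk⇔; Equivalence)
import Function.Properties.Equivalence as ⇔
open import Induction.WellFounded using (module All)
open import Relation.Binary.Construct.Closure.ReflexiveTransitive
  using (Star; ε; _◅_; _◅◅_) renaming (map to Star-map)
import Relation.Binary.Construct.On as On
open import Relation.Binary.PropositionalEquality
  using (_≡_; _≢_; refl; sym; trans; cong; subst; module ≡-Reasoning)
open import Relation.Nullary using (¬_; Dec; yes; no)

open Equivalence using (to; from)

module ParityWalks {U : Set} (A : U → U → Set) where

  -- The index is the parity of the length: true for odd walks.
  data ParityWalk : Bool → U → U → Set where
    []  : ∀ {p} → ParityWalk false p p
    _∷_ : ∀ {b p q r} → A p q → ParityWalk b q r → ParityWalk (not b) p r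

  infixr 5 _∷_ _++_

  _++_ : ∀ {b c p q r} → ParityWalk b p q → ParityWalk c q r → ParityWalk (b xor c) p r
  [] ++ w′ = w′
  _++_ {c = c} (_∷_ {b = b} a w) w′ =
    subst (λ d → ParityWalk d _ _) (not-distribˡ-xor b c) (a ∷ (w ++ w′))

  fromStar : ∀ {p q} → Star A p q → ∃ λ b → ParityWalk b p q
  fromStar ε       = false , []
  fromStar (a ◅ s) = map not (a ∷_) (fromStar s)

  walkLength : Bool → ℕ → ℕ
  walkLength false k = k + k
  walkLength true  k = suc (k + k)

  toWalk : ∀ {b p q} → ParityWalk b p q → ∃ λ k → Walk A (walkLength b k) p q
  toWalk [] = 0 , []
  toWalk (_∷_ {b = false} a w) = map₂ (a ∷_) (toWalk w)
  toWalk (_∷_ {b = true} {q = q} {r = r} a w) with k , w′ ← toWalk w =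
    suc k , a ∷ subst (λ l → Walk A l q r) (sym (+-suc k k)) w′

  fromWalk : ∀ b k {p q} → Walk A (walkLength b k) p q → ParityWalk b p q
  fromWalk false zero    []      = []
  fromWalk false (suc k) {q = r} (_∷_ {q = q} a w) =
    a ∷ fromWalk true k (subst (λ l → Walk A l q r) (+-suc k k) w)
  fromWalk true  k       (a ∷ w) = a ∷ fromWalk false k w

  colour-parity : (c : U → Bool) → (∀ {p q} → A p q → c p ≢ c q) →
                  ∀ {b p q} → ParityWalk b p q → c q ≡ b xor c p
  colour-parity c proper [] = refl
  colour-parity c proper {p = p} (_∷_ {b = b} {q = q} {r = r} a w) = begin
    c r               ≡⟨ colour-parity c proper w ⟩
    b xor c q         ≡⟨ cong (b xor_) (¬-not (proper a ∘ sym)) ⟩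
    b xor not (c p)   ≡⟨ sym (not-distribʳ-xor b (c p)) ⟩
    not (b xor c p)   ≡⟨ not-distribˡ-xor b (c p) ⟩
    not b xor c p     ∎
    where open ≡-Reasoning

  module _ (A-sym : ∀ {p q} → A p q → A q p) where

    reverse : ∀ {b p q} → ParityWalk b p q → ParityWalk b q p
    reverse []                = []
    reverse (_∷_ {b = b} a w) =
      subst (λ d → ParityWalk d _ _) (xor-comm b true) (reverse w ++ A-sym a ∷ [])

    odd-cycle : ∀ {b p u v} → ParityWalk b p u → A u v → ParityWalk b p v → ParityWalk true p p
    odd-cycle {b} wu a wv = subst (λ d → ParityWalk d _ _) (xor-inverseʳ b) (wu ++ a ∷ reverse wv)

module Flags {n : ℕ} (Γ : IncidenceSystem n) (G : IsGeometry Γ) where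
  open IncidenceSystem Γ
  open IsGeometry G

  IncidentTo : (Fin n → Maybe X) → X → Set
  IncidentTo F w = ∀ i x → F i ≡ just x → w * x

  extend : (Fin n → Maybe X) → X → Fin n → Maybe X
  extend F z i with i ≟ t z
  ... | yes _ = just z
  ... | no  _ = F i

  extend-at : ∀ F z → extend F z (t z) ≡ just z
  extend-at F z with t z ≟ t z
  ... | yes _   = refl
  ... | no  t≢t = ⊥-elim (t≢t refl)

  extend-elsewhere : ∀ {F z i} → i ≢ t z → extend F z i ≡ F i
  extend-elsewhere {z = z} {i = i} i≢tz with i ≟ t z
  ... | yes i≡tz = ⊥-elim (i≢tz i≡tz)
  ... | no  _    = refl

  extend-free⁻ : ∀ {F z i} → extend F z i ≡ nothing → F i ≡ nothing
  extend-free⁻ {z = z} {i = i} e with i ≟ t z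
  extend-free⁻ () | yes _
  ... | no _ = e

  IncidentTo-extend : ∀ {F z w} → IncidentTo F w → w * z → IncidentTo (extend F z) w
  IncidentTo-extend {z = z} w∣F wz i x e with i ≟ t z
  ... | yes _ = subst (_ *_) (just-injective e) wz
  ... | no  _ = w∣F i x e

  IncidentTo-extend⁻ : ∀ {F z w} → IncidentTo (extend F z) w → w * z
  IncidentTo-extend⁻ {F} {z} w∣Fz = w∣Fz (t z) z (extend-at F z)

  insert : (φ : Flag Γ) (z : X) → IncidentTo (Flag.F φ) z → Flag Γ
  insert φ z z∣φ = record { F = extend F z ; typed = typed ; incident = incident }
    where
    F = Flag.F φ

    typed : ∀ i x → extend F z i ≡ just x → t x ≡ i
    typed i x e with i ≟ t z
    ... | yes i≡tz = trans (cong t (sym (just-injective e))) (sym i≡tz)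
    ... | no  _    = Flag.typed φ i x e

    members-incident : ∀ i x → extend F z i ≡ just x → IncidentTo (extend F z) x
    members-incident i x e with i ≟ t z
    ... | yes _ = subst (IncidentTo (extend F z)) (just-injective e) (IncidentTo-extend z∣φ (*-refl z))
    ... | no  _ = IncidentTo-extend (λ j y → Flag.incident φ i j x y e) (*-sym (z∣φ i x e))

    incident : ∀ i j x y → extend F z i ≡ just x → extend F z j ≡ just y → x * y
    incident i j x y ex = members-incident i x ex j y

  ⊆-extend : (φ : Flag Γ) → ∀ {z} → IncidentTo (Flag.F φ) z →
             _⊆F_ Γ (Flag.F φ) (extend (Flag.F φ) z)
  ⊆-extend φ {z} z∣φ i x e with i ≟ t z
  ... | yes i≡tz = cong just (*-type (z∣φ i x e) (sym (trans (Flag.typed φ i x e) i≡tz)))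
  ... | no  _    = e

  emptyFlag : Flag Γ
  emptyFlag = record { F = λ _ → nothing ; typed = λ _ _ () ; incident = λ _ _ _ _ () }

  singleton : X → Flag Γ
  singleton x = insert emptyFlag x (λ _ _ ())

  chamber-element : (φ : Flag Γ) (i : Fin n) → ∃ λ e → (t e ≡ i) × IncidentTo (Flag.F φ) e
  chamber-element φ i =
    let ψ , φ⊆ψ , full = chamber φ
        e , ψi≡e = full i
    in e , Flag.typed ψ i e ψi≡e , λ j x φj≡x → Flag.incident ψ i j e x ψi≡e (φ⊆ψ j x φj≡x)

  chamber-element-through : (φ : Flag Γ) → ∀ {z z′} →
                            IncidentTo (Flag.F φ) z → IncidentTo (Flag.F φ) z′ → z * z′ → (i : Fin n) →
                            ∃ λ e → (t e ≡ i) × IncidentTo (Flag.F φ) e × (e * z) × (e * z′)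
  chamber-element-through φ {z} {z′} z∣φ z′∣φ zz′ i =
    let e , te , e∣ψ = chamber-element ψ i
    in e , te , (λ j x φj≡x → e∣ψ j x (φz⊆ψ j x (⊆-extend φ z∣φ j x φj≡x))) ,
       e∣ψ (t z) z (φz⊆ψ (t z) z (extend-at _ z)) , IncidentTo-extend⁻ e∣ψ
    where
    z′∣φz : IncidentTo (extend (Flag.F φ) z) z′
    z′∣φz = IncidentTo-extend z′∣φ (*-sym zz′)

    ψ : Flag Γ
    ψ = insert (insert φ z z∣φ) z′ z′∣φz

    φz⊆ψ : _⊆F_ Γ (extend (Flag.F φ) z) (Flag.F ψ)
    φz⊆ψ = ⊆-extend (insert φ z z∣φ) z′∣φz

  free-antitone : ∀ {F H} → _⊆F_ Γ F H → ∀ {i} → H i ≡ nothing → F i ≡ nothing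
  free-antitone {F} F⊆H {i} Hi≡nothing with F i in Fi≡
  ... | nothing = refl
  ... | just x  with () ← trans (sym (F⊆H i x Fi≡)) Hi≡nothing

  InRes-mono : ∀ {F H w} → _⊆F_ Γ F H → InRes Γ H w → InRes Γ F w
  InRes-mono F⊆H (free , w∣H) = free-antitone F⊆H free , λ i x e → w∣H i x (F⊆H i x e)

  InRes-extend : ∀ {F z w} → InRes Γ F w → w * z → t w ≢ t z → InRes Γ (extend F z) w
  InRes-extend (free , w∣F) wz tw≢tz = trans (extend-elsewhere tw≢tz) free , IncidentTo-extend w∣F wz

  freeTypes : (Fin n → Maybe X) → Subset n
  freeTypes F = tabulate (is-nothing ∘ F)

  ∈-freeTypes : ∀ {F i} → i ∈ freeTypes F ⇔ F i ≡ nothing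
  ∈-freeTypes {F} {i} = mk⇔ (is-nothing⇒ (F i) ∘ trans (sym (lookup∘tabulate _ i)) ∘ []=⇒lookup)
                            (λ e → lookup⇒[]= i _ (trans (lookup∘tabulate _ i) (cong is-nothing e)))
    where
    is-nothing⇒ : (mx : Maybe X) → is-nothing mx ≡ true → mx ≡ nothing
    is-nothing⇒ nothing  _ = refl
    is-nothing⇒ (just _) ()

  freeTypes-extend : ∀ {F z} → F (t z) ≡ nothing → freeTypes (extend F z) ⊂ freeTypes F
  freeTypes-extend {F} {z} free =
    (λ i∈ → from ∈-freeTypes (extend-free⁻ {F} {z} (to ∈-freeTypes i∈))) ,
    t z , from ∈-freeTypes free ,
    λ tz∈ → just≢nothing (trans (sym (extend-at F z)) (to ∈-freeTypes tz∈))
    where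
    just≢nothing : ∀ {x : X} → just x ≢ nothing
    just≢nothing ()

  corank : Flag Γ → ℕ
  corank φ = ∣ freeTypes (Flag.F φ) ∣

  corank-insert : (φ : Flag Γ) → ∀ {z} (z∣φ : IncidentTo (Flag.F φ) z) →
                  Flag.F φ (t z) ≡ nothing → corank (insert φ z z∣φ) < corank φ
  corank-insert φ _ free = p⊂q⇒∣p∣<∣q∣ (freeTypes-extend free)

module ResidueGraphs {m : ℕ} (Γ : IncidenceSystem (3 + m)) (G : IsGeometry Γ) where
  open IncidenceSystem Γ
  open IsGeometry G
  open Flags Γ G

  ResidueAdj : (Fin (3 + m) → Maybe X) → X → X → Set
  ResidueAdj F p q = InRes Γ F p × InRes Γ F q × (t p ≡ t0 Γ) × (t q ≡ t0 Γ) × (p ≢ q) ×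
                     ∃ λ e → (t e ≡ t1 Γ) × InRes Γ F e × (e * p) × (e * q)

  ResidueAdj-mono : ∀ {F H p q} → _⊆F_ Γ F H → ResidueAdj H p q → ResidueAdj F p q
  ResidueAdj-mono F⊆H (rp , rq , tp , tq , p≢q , e , te , re , ep , eq) =
    InRes-mono F⊆H rp , InRes-mono F⊆H rq , tp , tq , p≢q , e , te , InRes-mono F⊆H re , ep , eq

  Shadow : (Fin (3 + m) → Maybe X) → X → X → Set
  Shadow F z a = (t a ≡ t0 Γ) × InRes Γ F a × (a * z)

  common-shadow : (φ : Flag Γ) → Flag.F φ (t0 Γ) ≡ nothing →
                  ∀ {z z′} → InRes Γ (Flag.F φ) z → InRes Γ (Flag.F φ) z′ → z * z′ →
                  ∃ λ a → Shadow (Flag.F φ) z a × Shadow (Flag.F φ) z′ a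
  common-shadow φ free0 (_ , z∣φ) (_ , z′∣φ) zz′ =
    let a , ta , a∣φ , az , az′ = chamber-element-through φ z∣φ z′∣φ zz′ (t0 Γ)
        a∈Res = subst (λ i → Flag.F φ i ≡ nothing) (sym ta) free0 , a∣φ
    in a , (ta , a∈Res , az) , (ta , a∈Res , az′)

  Residue01Connected : Flag Γ → Set
  Residue01Connected φ =
    Flag.F φ (t0 Γ) ≡ nothing → Flag.F φ (t1 Γ) ≡ nothing →
    ∀ {p q} → t p ≡ t0 Γ → t q ≡ t0 Γ → InRes Γ (Flag.F φ) p → InRes Γ (Flag.F φ) q →
    Star (ResidueAdj (Flag.F φ)) p q

  module _ (em : ∀ {ℓ} → ExcludedMiddle ℓ) (RC : ResiduallyConnected Γ) where

    -- Consecutive elements of a path in Res φ have a common shadow, and the shadow of a single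
    -- element z is connected: it is z itself, the two ends of the edge z, or Γ_{φ ∪ z}[0,1].
    residue01-connected : (φ : Flag Γ) → Residue01Connected φ
    residue01-connected = All.wfRec (On.wellFounded corank <-wellFounded) _ Residue01Connected step
      where
      step : ∀ φ → (∀ {ψ} → corank ψ < corank φ → Residue01Connected ψ) → Residue01Connected φ
      step φ IH free0 free1 tp tq rp rq =
        walk-shadows rp (RC φ (t0 Γ , t1 Γ , (λ ()) , free0 , free1) _ _ rp rq)
                     (tp , rp , *-refl _) (tq , rq , *-refl _)
        where
        F = Flag.F φ

        shadow-connected : ∀ {z a b} → InRes Γ F z → Shadow F z a → Shadow F z b →
                           Star (ResidueAdj F) a b
        shadow-connected {z} {a} {b} rz (ta , ra , az) (tb , rb , bz)
          with t z ≟ t0 Γ | t z ≟ t1 Γ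
        ... | yes tz≡t0 | _
          with refl ← *-type az (trans ta (sym tz≡t0)) | refl ← *-type bz (trans tb (sym tz≡t0)) = ε
        ... | no _ | yes tz≡t1 with em {P = a ≡ b}
        ...   | yes refl = ε
        ...   | no a≢b   = (ra , rb , ta , tb , a≢b , z , tz≡t1 , rz , *-sym az , *-sym bz) ◅ ε
        shadow-connected {z} {a} {b} rz (ta , ra , az) (tb , rb , bz) | no tz≢t0 | no tz≢t1 =
          Star-map (ResidueAdj-mono (⊆-extend φ (proj₂ rz)))
            (IH {insert φ z (proj₂ rz)} (corank-insert φ (proj₂ rz) (proj₁ rz))
                (trans (extend-elsewhere (tz≢t0 ∘ sym)) free0)
                (trans (extend-elsewhere (tz≢t1 ∘ sym)) free1)
                ta tb
                (InRes-extend ra az (λ e → tz≢t0 (trans (sym e) ta)))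
                (InRes-extend rb bz (λ e → tz≢t0 (trans (sym e) tb))))

        walk-shadows : ∀ {z z′ a a′} → InRes Γ F z →
                       Star (λ u v → InRes Γ F u × InRes Γ F v × (u * v)) z z′ →
                       Shadow F z a → Shadow F z′ a′ → Star (ResidueAdj F) a a′
        walk-shadows rz ε sa sa′ = shadow-connected rz sa sa′
        walk-shadows rz ((_ , rw , zw) ◅ s) sa sa′ =
          let b , sbz , sbw = common-shadow φ free0 rz rw zw
          in shadow-connected rz sa sbz ◅◅ walk-shadows rw s sbw sa′

    local-connected : ∀ {x p q} → HighType Γ x → VertexAt Γ x p → VertexAt Γ x q →
                      Star (AdjAt Γ x) p q
    local-connected {x} (tx≢t0 , tx≢t1) (tp , px) (tq , qx) =
      Star-map residue⇒local
        (residue01-connected (singleton x)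
          (extend-elsewhere (tx≢t0 ∘ sym)) (extend-elsewhere (tx≢t1 ∘ sym))
          tp tq (in-residue tp px) (in-residue tq qx))
      where
      in-residue : ∀ {p} → t p ≡ t0 Γ → p * x → InRes Γ (Flag.F (singleton x)) p
      in-residue tp px = InRes-extend (refl , λ _ _ ()) px (λ e → tx≢t0 (trans (sym e) tp))

      residue⇒local : ∀ {p q} → ResidueAdj (Flag.F (singleton x)) p q → AdjAt Γ x p q
      residue⇒local (rp , rq , tp , tq , p≢q , e , te , re , ep , eq) =
        (tp , IncidentTo-extend⁻ (proj₂ rp)) , (tq , IncidentTo-extend⁻ (proj₂ rq)) , p≢q ,
        e , te , IncidentTo-extend⁻ (proj₂ re) , ep , eq

module Neighbours {m : ℕ} (Γ : IncidenceSystem (3 + m)) (G : IsGeometry Γ) (b1 : B1 Γ) (b2 : B2 Γ) where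
  open IncidenceSystem Γ
  open IsGeometry G
  open Flags Γ G

  other-endpoint : ∀ {e r} → t e ≡ t1 Γ → σ₀ Γ e r → ∃ λ s → (r ≢ s) × σ₀ Γ e s
  other-endpoint {e} {r} te er with proj₁ b1 e te
  ... | p , q , p≢q , ep , eq , endpoint with endpoint r er
  ...   | inj₁ refl = q , p≢q , eq
  ...   | inj₂ refl = p , p≢q ∘ sym , ep

  edge-at : ∀ {x e r s} → HighType Γ x → VertexAt Γ x r → t e ≡ t1 Γ → e * x → e * r →
            r ≢ s → σ₀ Γ e s → AdjAt Γ x r s
  edge-at {x} {e} {s = s} (tx≢t0 , tx≢t1) vr te ex er r≢s es =
    vr , to (b2 e x te tx≢t0 tx≢t1) ex s es , r≢s , e , te , ex , er , *-sym (proj₂ es)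

  common-neighbour : ∀ {x y r} → x * y → HighType Γ x → HighType Γ y →
                     VertexAt Γ x r → VertexAt Γ y r → ∃ λ s → AdjAt Γ x r s × AdjAt Γ y r s
  common-neighbour {x} xy hx hy (tr , rx) (_ , ry) =
    let e , te , e∣x , ey , er =
          chamber-element-through (singleton x) (on-x (*-sym xy)) (on-x rx) (*-sym ry) (t1 Γ)
        ex = IncidentTo-extend⁻ e∣x
        s , r≢s , es = other-endpoint te (tr , *-sym er)
    in s , edge-at hx (tr , rx) te ex er r≢s es , edge-at hy (tr , ry) te ey er r≢s es
    where
    on-x : ∀ {w} → w * x → IncidentTo (Flag.F (singleton x)) w
    on-x = IncidentTo-extend (λ _ _ ())

  neighbour : ∀ {x r} → HighType Γ x → VertexAt Γ x r → ∃ λ s → AdjAt Γ x r s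
  neighbour {x} hx vr = map₂ proj₁ (common-neighbour (*-refl x) hx hx vr vr)

module _ {m : ℕ} {Γ : IncidenceSystem (3 + m)} where
  open IncidenceSystem Γ

  bar-map : ∀ {x P Q r} → (∀ q → P q ⇔ Q q) → Bar Γ x P r → Bar Γ x Q r
  bar-map {r = r} P⇔Q (if-bip , if-not-bip) =
    (λ bip → map₂ (λ ¬Pr → ¬Pr ∘ from (P⇔Q r)) (if-bip bip)) , to (P⇔Q r) ∘ if-not-bip

  bar-cong : ∀ {x P Q r} → (∀ q → P q ⇔ Q q) → Bar Γ x P r ⇔ Bar Γ x Q r
  bar-cong P⇔Q = mk⇔ (bar-map P⇔Q) (bar-map (⇔.sym ∘ P⇔Q))

  Adj-sym : ∀ {p q} → Adj Γ p q → Adj Γ q p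
  Adj-sym (tp , tq , p≢q , e , te , ep , eq) = tq , tp , p≢q ∘ sym , e , te , eq , ep

module Classes {m : ℕ} {Γ : IncidenceSystem (3 + m)} (em : ∀ {ℓ} → ExcludedMiddle ℓ)
  (x : IncidenceSystem.X Γ)
  (connected : ∀ {p q} → VertexAt Γ x p → VertexAt Γ x q → Star (AdjAt Γ x) p q)
  (neighbour : ∀ {p} → VertexAt Γ x p → ∃ λ q → AdjAt Γ x p q)
  where
  open IncidenceSystem Γ
  open ParityWalks (AdjAt Γ x)

  V : X → Set
  V = VertexAt Γ x

  A : X → X → Set
  A = AdjAt Γ x

  A-sym : ∀ {p q} → A p q → A q p
  A-sym (vp , vq , p≢q , e , te , ex , ep , eq) = vq , vp , p≢q ∘ sym , e , te , ex , eq , ep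

  parity-walk : ∀ {p q} → V p → V q → ∃ λ b → ParityWalk b p q
  parity-walk vp vq = fromStar (connected vp vq)

  walk-target : ∀ {b p q} → V p → ParityWalk b p q → V q
  walk-target vp []      = vp
  walk-target _  (a ∷ w) = walk-target (proj₁ (proj₂ a)) w

  class⇒walk : ∀ {P q} (c : IsClass Γ x P) → P q → ParityWalk false (proj₁ c) q
  class⇒walk (_ , _ , P⇔) Pq = let _ , _ , k , w = to (P⇔ _) Pq in fromWalk false k w

  walk⇒class : ∀ {P q} (c : IsClass Γ x P) → ParityWalk false (proj₁ c) q → P q
  walk⇒class (_ , vb , P⇔) w = from (P⇔ _) (vb , walk-target vb w , toWalk w)

  class-vertex : ∀ {P q} → IsClass Γ x P → P q → V q
  class-vertex (_ , _ , P⇔) Pq = proj₁ (proj₂ (to (P⇔ _) Pq))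

  module _ (bip : BipartiteAt Γ x) where

    colour : X → Bool
    colour = proj₁ bip

    proper : ∀ {p q} → A p q → colour p ≢ colour q
    proper a = proj₂ bip _ _ (proj₁ a) (proj₁ (proj₂ a)) a

    even-walk-colour : ∀ {p q} → ParityWalk false p q → colour q ≡ colour p
    even-walk-colour = colour-parity colour proper

    class-colour : ∀ {P p q} (c : IsClass Γ x P) → P p → P q → colour p ≡ colour q
    class-colour c Pp Pq =
      trans (even-walk-colour (class⇒walk c Pp)) (sym (even-walk-colour (class⇒walk c Pq)))

    complement-class : ∀ {P q} (c : IsClass Γ x P) → A (proj₁ c) q →
                       ∀ r → (V r × ¬ P r) ⇔ EvenJoined Γ x q r
    complement-class {P} {q} c@(_ , vb , _) bq r = mk⇔ opposite⇒even even⇒opposite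
      where
      opposite⇒even : V r × ¬ P r → EvenJoined Γ x q r
      opposite⇒even (vr , ¬Pr) with parity-walk vb vr
      ... | false , w = ⊥-elim (¬Pr (walk⇒class c w))
      ... | true  , w = proj₁ (proj₂ bq) , vr , toWalk (A-sym bq ∷ w)

      even⇒opposite : EvenJoined Γ x q r → V r × ¬ P r
      even⇒opposite (_ , vr , k , w) =
        vr , λ Pr → proper bq (trans (class-colour c (walk⇒class c []) Pr)
                                     (even-walk-colour (fromWalk false k w)))

  -- Otherwise colouring each vertex by the parity of a walk from p would bipartition the graph.
  odd-closed-walk : ¬ BipartiteAt Γ x → ∀ {p} → V p → ParityWalk true p p
  odd-closed-walk non-bip {p} vp with em {P = ParityWalk true p p}
  ... | yes w = w
  ... | no no-odd-walk =
    ⊥-elim (non-bip (parity-colour , λ u v vu vv a same →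
      no-odd-walk (odd-cycle A-sym (walk u em vu) a
                                 (subst (λ b → ParityWalk b p v) (sym same) (walk v em vv)))))
    where
    colourBy : ∀ v → Dec (V v) → Bool
    colourBy v (yes vv) = proj₁ (parity-walk vp vv)
    colourBy v (no _)   = false

    walk : ∀ v (d : Dec (V v)) → V v → ParityWalk (colourBy v d) p v
    walk v (yes vv) _  = proj₂ (parity-walk vp vv)
    walk v (no ¬vv) vv = ⊥-elim (¬vv vv)

    parity-colour : X → Bool
    parity-colour v = colourBy v em

  even-walk : ¬ BipartiteAt Γ x → ∀ {p q} → V p → V q → ParityWalk false p q
  even-walk non-bip vp vq with parity-walk vp vq
  ... | false , w = w
  ... | true  , w = odd-closed-walk non-bip vp ++ w

  bar-bipartite : ∀ P {q} → BipartiteAt Γ x → Bar Γ x P q ⇔ (V q × ¬ P q)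
  bar-bipartite P bip =
    mk⇔ (λ bar → proj₁ bar bip) (λ h → (λ _ → h) , λ non-bip → ⊥-elim (non-bip bip))

  bar-non-bipartite : ∀ P {q} → ¬ BipartiteAt Γ x → Bar Γ x P q ⇔ P q
  bar-non-bipartite P non-bip =
    mk⇔ (λ bar → proj₂ bar non-bip) (λ Pq → (λ bip → ⊥-elim (non-bip bip)) , λ _ → Pq)

  bar-across-edge : ∀ {P r s} → IsClass Γ x P → P r → A r s → Bar Γ x P s
  bar-across-edge {P} c Pr a with em {P = BipartiteAt Γ x}
  ... | yes bip    = from (bar-bipartite P bip)
                          (proj₁ (proj₂ a) , λ Ps → proper bip a (class-colour bip c Pr Ps))
  ... | no non-bip = from (bar-non-bipartite P non-bip)
                          (walk⇒class c (even-walk non-bip (proj₁ (proj₂ c)) (proj₁ (proj₂ a))))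

  bar-class : ∀ {P} → IsClass Γ x P → IsClass Γ x (Bar Γ x P)
  bar-class {P} c@(b , vb , P⇔) with em {P = BipartiteAt Γ x}
  ... | no non-bip = b , vb , λ r → ⇔.trans (bar-non-bipartite P non-bip) (P⇔ r)
  ... | yes bip    =
    let q , bq = neighbour vb
    in q , proj₁ (proj₂ bq) , λ r → ⇔.trans (bar-bipartite P bip) (complement-class bip c bq r)

  bar-bar : ∀ {P q} → IsClass Γ x P → Bar Γ x (Bar Γ x P) q ⇔ P q
  bar-bar {P} {q} c with em {P = BipartiteAt Γ x}
  ... | no non-bip = ⇔.trans (bar-non-bipartite (Bar Γ x P) non-bip) (bar-non-bipartite P non-bip)
  ... | yes bip    = ⇔.trans (bar-bipartite (Bar Γ x P) bip) (mk⇔ double-complement complement-of-bar)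
    where
    double-complement : V q × ¬ Bar Γ x P q → P q
    double-complement (vq , ¬bar) with em {P = P q}
    ... | yes Pq = Pq
    ... | no ¬Pq = ⊥-elim (¬bar (from (bar-bipartite P bip) (vq , ¬Pq)))

    complement-of-bar : P q → V q × ¬ Bar Γ x P q
    complement-of-bar Pq = class-vertex c Pq , λ bar → proj₂ (to (bar-bipartite P bip) bar) Pq

module Correlation {m : ℕ} {Γ : IncidenceSystem (3 + m)} (em : ∀ {ℓ} → ExcludedMiddle ℓ)
  (G : IsGeometry Γ) (RC : ResiduallyConnected Γ) (b1 : B1 Γ) (b2 : B2 Γ) where
  open IncidenceSystem Γ
  open ResidueGraphs Γ G using (local-connected)
  open Neighbours Γ G b1 b2 using (common-neighbour; neighbour)

  module At {x : X} (hx : HighType Γ x) = Classes em x (local-connected em RC hx) (neighbour hx)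

  α : PElt Γ → PElt Γ
  α (pt0 p tp)     = pt1 p tp
  α (pt1 p tp)     = pt0 p tp
  α (cls x hx P c) = cls x hx (Bar Γ x P) (At.bar-class hx c)

  α-is-alpha : IsAlpha Γ α
  α-is-alpha = (λ _ _ → refl) , (λ _ _ → refl) ,
               λ x hx P c → Bar Γ x P , At.bar-class hx c , (refl , λ _ → ⇔.refl) , λ _ → ⇔.refl

  α-cong : ∀ a b → _≈_ Γ a b → _≈_ Γ (α a) (α b)
  α-cong (pt0 _ _)     (pt0 _ _)      p≡q          = p≡q
  α-cong (pt1 _ _)     (pt1 _ _)      p≡q          = p≡q
  α-cong (cls _ _ _ _) (cls _ _ _ _)  (refl , P⇔Q) = refl , λ _ → bar-cong P⇔Q
  α-cong (pt0 _ _)     (pt1 _ _)      ()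
  α-cong (pt0 _ _)     (cls _ _ _ _)  ()
  α-cong (pt1 _ _)     (pt0 _ _)      ()
  α-cong (pt1 _ _)     (cls _ _ _ _)  ()
  α-cong (cls _ _ _ _) (pt0 _ _)      ()
  α-cong (cls _ _ _ _) (pt1 _ _)      ()

  α-injective : ∀ a b → _≈_ Γ (α a) (α b) → _≈_ Γ a b
  α-injective (pt0 _ _)       (pt0 _ _)       p≡q            = p≡q
  α-injective (pt1 _ _)       (pt1 _ _)       p≡q            = p≡q
  α-injective (cls _ hx _ c)  (cls _ _ _ d)   (refl , P̄⇔Q̄) =
    refl , λ r → ⇔.trans (⇔.sym (At.bar-bar hx c)) (⇔.trans (bar-cong P̄⇔Q̄) (At.bar-bar hx d))
  α-injective (pt0 _ _)       (pt1 _ _)       ()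
  α-injective (pt0 _ _)       (cls _ _ _ _)   ()
  α-injective (pt1 _ _)       (pt0 _ _)       ()
  α-injective (pt1 _ _)       (cls _ _ _ _)   ()
  α-injective (cls _ _ _ _)   (pt0 _ _)       ()
  α-injective (cls _ _ _ _)   (pt1 _ _)       ()

  α-surjective : ∀ b → Σ (PElt Γ) λ a → _≈_ Γ (α a) b
  α-surjective (pt0 p tp)     = pt1 p tp , refl
  α-surjective (pt1 p tp)     = pt0 p tp , refl
  α-surjective (cls y hy Q d) =
    cls y hy (Bar Γ y Q) (At.bar-class hy d) , refl , λ _ → At.bar-bar hy d

  α-resp-type : ∀ a b → t′ Γ a ≡ t′ Γ b → t′ Γ (α a) ≡ t′ Γ (α b)
  α-resp-type (pt0 _ _)      (pt0 _ _)      _     = refl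
  α-resp-type (pt1 _ _)      (pt1 _ _)      _     = refl
  α-resp-type (cls _ _ _ _)  (cls _ _ _ _)  tx≡ty = tx≡ty
  α-resp-type (pt0 _ _)      (pt1 _ _)      ()
  α-resp-type (pt1 _ _)      (pt0 _ _)      ()
  α-resp-type (pt0 _ _)      (cls _ hy _ _) t0≡ty = ⊥-elim (proj₁ hy (sym t0≡ty))
  α-resp-type (pt1 _ _)      (cls _ hy _ _) t1≡ty = ⊥-elim (proj₂ hy (sym t1≡ty))
  α-resp-type (cls _ hx _ _) (pt0 _ _)      tx≡t0 = ⊥-elim (proj₁ hx tx≡t0)
  α-resp-type (cls _ hx _ _) (pt1 _ _)      tx≡t1 = ⊥-elim (proj₂ hx tx≡t1)

  meet-bar : ∀ {x y P Q} → x * y → (hx : HighType Γ x) (hy : HighType Γ y) →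
             IsClass Γ x P → IsClass Γ y Q →
             (∃ λ r → P r × Q r) → ∃ λ r → Bar Γ x P r × Bar Γ y Q r
  meet-bar xy hx hy c d (r , Pr , Qr) =
    let s , rs-at-x , rs-at-y =
          common-neighbour xy hx hy (At.class-vertex hx c Pr) (At.class-vertex hy d Qr)
    in s , At.bar-across-edge hx c Pr rs-at-x , At.bar-across-edge hy d Qr rs-at-y

  meet-of-bars : ∀ {x y P Q} → x * y → (hx : HighType Γ x) (hy : HighType Γ y) →
                 IsClass Γ x P → IsClass Γ y Q →
                 (∃ λ r → Bar Γ x P r × Bar Γ y Q r) → ∃ λ r → P r × Q r
  meet-of-bars xy hx hy c d meet =
    let s , P̿s , Q̿s = meet-bar xy hx hy (At.bar-class hx c) (At.bar-class hy d) meet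
    in s , to (At.bar-bar hx c) P̿s , to (At.bar-bar hy d) Q̿s

  α-incidence : ∀ a b → (_*′_ Γ a b) ⇔ (_*′_ Γ (α a) (α b))
  α-incidence (pt0 _ _)       (pt0 _ _)       = ⇔.refl
  α-incidence (pt1 _ _)       (pt1 _ _)       = ⇔.refl
  α-incidence (pt0 _ _)       (pt1 _ _)       = mk⇔ Adj-sym Adj-sym
  α-incidence (pt1 _ _)       (pt0 _ _)       = mk⇔ Adj-sym Adj-sym
  α-incidence (pt0 _ _)       (cls _ hy _ d)  = ⇔.refl ×-⇔ ⇔.sym (At.bar-bar hy d)
  α-incidence (cls _ hy _ d)  (pt0 _ _)       = ⇔.refl ×-⇔ ⇔.sym (At.bar-bar hy d)
  α-incidence (pt1 _ _)       (cls _ _ _ _)   = ⇔.refl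
  α-incidence (cls _ _ _ _)   (pt1 _ _)       = ⇔.refl
  α-incidence (cls _ hx _ c)  (cls _ hy _ d)  =
    mk⇔ (λ (xy , meet) → xy , meet-bar xy hx hy c d meet)
        (λ (xy , meet) → xy , meet-of-bars xy hx hy c d meet)

proposition3p15 : (em : ∀ {ℓ} → ExcludedMiddle ℓ) →
    (m : ℕ) (Γ : IncidenceSystem (3 + m)) →
    IsGeometry Γ → ResiduallyConnected Γ → B1 Γ → B2 Γ → ¬ Bipartite01 Γ →
    Σ (PElt Γ → PElt Γ) λ α → IsAlpha Γ α × IsCorrelation Γ α
proposition3p15 em m Γ G RC b1 b2 _ =
  α , α-is-alpha , α-cong , α-injective , α-surjective , α-resp-type , α-incidence
  where open Correlation em G RC b1 b2
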